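{- Let $k\ge2$ be an integer. For all integers $x\ge2$ we have $\operatorname{ex}(2x,2k)\le 6\operatorname{ex}(x,2k)$.
   Context: $\operatorname{ex}(n,2k)$ is the maximum number of edges of a (simple) graph on $n$ vertices with girth at least $2k$, where the girth is the length of a shortest cycle (infinity if there is none). -}

module Defs where

open import Data.Nat using (ℕ; zero; suc; _+_; _*_; _≤_; _<_; _≥_)
open import Data.Nat.Properties using (_<?_)
open import Data.Bool using (Bool; true; false; if_then_else_)
open import Data.Fin using (Fin; zero; suc; toℕ; inject₁; fromℕ)
open import Data.List using (List; map; allFin)
open import Data.Nat.ListAction using (sum)
open import Data.Product using (Σ; _×_; _,_)
open import Function.Definitions using (Injective)
open import Relation.Binary.PropositionalEquality using (_≡_)
open import Relation.Nullary.Decidable using (⌊_⌋)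

record Graph (n : ℕ) : Set where
  field
    adj   : Fin n → Fin n → Bool
    sym   : ∀ i j → adj i j ≡ adj j i
    irref : ∀ i → adj i i ≡ false
open Graph public

edges : ∀ {n} → Graph n → ℕ
edges {n} G =
  sum (map (λ i → sum (map (λ j →
         if ⌊ toℕ i <? toℕ j ⌋ then (if adj G i j then 1 else 0) else 0)
       (allFin n))) (allFin n))

record Cycle {n : ℕ} (G : Graph n) (len : ℕ) : Set where
  field
    m       : ℕ
    len≡    : len ≡ suc m
    len≥3   : 3 ≤ len
    v       : Fin (suc m) → Fin n
    inj     : Injective _≡_ _≡_ v
    step    : ∀ (i : Fin m) → adj G (v (inject₁ i)) (v (suc i)) ≡ true
    close   : adj G (v (fromℕ m)) (v zero) ≡ true

GirthAtLeast : ∀ {n} → Graph n → ℕ → Set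
GirthAtLeast G g = ∀ len → Cycle G len → g ≤ len

-- IsEx n g e : e = ex(n, g), the maximum number of edges of a simple graph
-- on n vertices with girth at least g.
IsEx : ℕ → ℕ → ℕ → Set
IsEx n g e =
  Σ (Graph n) (λ G → GirthAtLeast G g × edges G ≡ e)
  × (∀ (G : Graph n) → GirthAtLeast G g → edges G ≤ e)

module Submission where

-- If the pairs of a vertex set V of size N can be covered by c
-- subsets of V of size x each (every pair {u, v} inside one of them), then
-- every edge of a graph G on V lies in one of the c induced subgraphs; these
-- have x vertices and inherit the girth bound of G, so
-- ex(N, g) ≤ c · ex(x, g) for every g.  For N = 2x and c = 6 such a cover
-- exists: write x = 2q + 3r and cut Fin (2x) into seven consecutive blocks of
-- sizes r, q, r, q+r, q+r, r, q+r; six unions of blocks, each of total size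
-- 2q + 3r, contain every pair of blocks.

open import Defs hiding (sym)
open import Data.Nat using (ℕ; zero; suc; _+_; _*_; _≤_; _<_; z≤n; s≤s)
open import Data.Nat.Properties
  using (+-*-semiring; +-assoc; +-mono-≤; ≤-trans; m≤m+n; m≤n+m; _<?_; _≟_; module ≤-Reasoning)
open import Data.Nat.ListAction using (sum)
open import Data.Nat.Tactic.RingSolver using (solve-∀)
open import Algebra.Properties.Semiring.Sum +-*-semiring
  using (sum-cong-≗; sum-replicate-zero; ∑-distrib-+; ∑-comm; *-distribʳ-sum)
  renaming (sum to ∑)
open import Data.Bool using (Bool; true; false; if_then_else_)
open import Data.Bool.Properties using () renaming (_≟_ to _≟ᵇ_)
open import Data.Fin as Fin using (Fin; zero; suc; toℕ; splitAt; _↑ˡ_; _↑ʳ_)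
open import Data.Fin.Properties using (all?; any?; splitAt-↑ˡ; splitAt-↑ʳ; <-cmp; <-irrefl; <-asym)
open import Data.List using (map; tabulate; allFin)
open import Data.List.Properties using (map-tabulate)
open import Data.Vec using (Vec; []; _∷_; lookup)
open import Data.Product using (∃; ∃₂; _×_; _,_)
open import Data.Sum using ([_,_]′)
open import Data.Empty using (⊥-elim)
open import Function using (_∘_; id)
open import Function.Definitions using (Injective)
open import Relation.Binary.Definitions using (tri<; tri≈; tri>)
open import Relation.Binary.PropositionalEquality
  using (_≡_; refl; sym; trans; cong; cong₂; subst; module ≡-Reasoning)
open import Relation.Nullary using (Dec; yes; no)
open import Relation.Nullary.Decidable using (⌊_⌋; isYes≗does; dec-true; dec-false; toWitness; _×-dec_)

-- Finite sums over Fin n.  'edges' is phrased with lists; 'sum-allFin'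
-- translates it to the library's ∑, which comes with the usual algebra.

sum-allFin : ∀ {n} (f : Fin n → ℕ) → sum (map f (allFin n)) ≡ ∑ f
sum-allFin f = trans (cong sum (map-tabulate id f)) (sum-tabulate f)
  where
  sum-tabulate : ∀ {n} (g : Fin n → ℕ) → sum (tabulate g) ≡ ∑ g
  sum-tabulate {zero}  g = refl
  sum-tabulate {suc n} g = cong (g zero +_) (sum-tabulate (g ∘ suc))

∑-mono-≤ : ∀ {n} {f g : Fin n → ℕ} → (∀ i → f i ≤ g i) → ∑ f ≤ ∑ g
∑-mono-≤ {zero}  f≤g = z≤n
∑-mono-≤ {suc n} f≤g = +-mono-≤ (f≤g zero) (∑-mono-≤ (f≤g ∘ suc))

∑-≤-* : ∀ {n b} {f : Fin n → ℕ} → (∀ i → f i ≤ b) → ∑ f ≤ n * b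
∑-≤-* {zero}  f≤b = z≤n
∑-≤-* {suc n} f≤b = +-mono-≤ (f≤b zero) (∑-≤-* (f≤b ∘ suc))

term-≤-∑ : ∀ {n} (f : Fin n → ℕ) i → f i ≤ ∑ f
term-≤-∑ f zero    = m≤m+n _ _
term-≤-∑ f (suc i) = ≤-trans (term-≤-∑ (f ∘ suc) i) (m≤n+m _ _)

∑-split : ∀ m {n} (f : Fin (m + n) → ℕ) → ∑ f ≡ ∑ (f ∘ (_↑ˡ n)) + ∑ (f ∘ (m ↑ʳ_))
∑-split zero    f = refl
∑-split (suc m) f = trans (cong (f zero +_) (∑-split m (f ∘ suc))) (sym (+-assoc (f zero) _ _))

restrict : ∀ {n} → (Fin n → Bool) → (Fin n → ℕ) → Fin n → ℕ
restrict S f u = if S u then f u else 0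

∑-guard : ∀ {n} (b : Bool) (f : Fin n → ℕ) → (if b then ∑ f else 0) ≡ ∑ (λ i → if b then f i else 0)
∑-guard {n} true  f = refl
∑-guard {n} false f = sym (sum-replicate-zero n)

∑-restrict-linear : ∀ {n} (S : Fin n → Bool) (α β : Fin n → ℕ) q r →
  ∑ (restrict S (λ i → α i * q + β i * r)) ≡ ∑ (restrict S α) * q + ∑ (restrict S β) * r
∑-restrict-linear S α β q r = begin
  ∑ (restrict S (λ i → α i * q + β i * r))
    ≡⟨ sum-cong-≗ pointwise ⟩
  ∑ (λ i → restrict S α i * q + restrict S β i * r)
    ≡⟨ ∑-distrib-+ (λ i → restrict S α i * q) (λ i → restrict S β i * r) ⟩
  ∑ (λ i → restrict S α i * q) + ∑ (λ i → restrict S β i * r)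
    ≡⟨ sym (cong₂ _+_ (*-distribʳ-sum q (restrict S α)) (*-distribʳ-sum r (restrict S β))) ⟩
  ∑ (restrict S α) * q + ∑ (restrict S β) * r ∎
  where
  open ≡-Reasoning
  pointwise : ∀ i → restrict S (λ i → α i * q + β i * r) i ≡ restrict S α i * q + restrict S β i * r
  pointwise i with S i
  ... | true  = refl
  ... | false = refl

count : ∀ {n} → (Fin n → Bool) → ℕ
count S = ∑ (restrict S (λ _ → 1))

count-const : ∀ n b → count {n} (λ _ → b) ≡ (if b then n else 0)
count-const zero    true  = refl
count-const zero    false = refl
count-const (suc n) true  = cong suc (count-const n true)
count-const (suc n) false = count-const n false

enum : ∀ {n} (S : Fin n → Bool) → Fin (count S) → Fin n
enum {suc n} S i with S zero
enum {suc n} S zero    | true  = zero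
enum {suc n} S (suc i) | true  = suc (enum (S ∘ suc) i)
enum {suc n} S i       | false = suc (enum (S ∘ suc) i)

StrictlyIncreasing : ∀ {m n} → (Fin m → Fin n) → Set
StrictlyIncreasing f = ∀ {i j} → i Fin.< j → f i Fin.< f j

enum-increasing : ∀ {n} (S : Fin n → Bool) → StrictlyIncreasing (enum S)
enum-increasing {suc n} S {i} {j} i<j with S zero
enum-increasing {suc n} S {zero}  {suc j} i<j       | true  = s≤s z≤n
enum-increasing {suc n} S {suc i} {suc j} (s≤s i<j) | true  = s≤s (enum-increasing (S ∘ suc) i<j)
enum-increasing {suc n} S {i}     {j}     i<j       | false = s≤s (enum-increasing (S ∘ suc) i<j)

∑-enum : ∀ {n} (S : Fin n → Bool) (g : Fin n → ℕ) → ∑ (g ∘ enum S) ≡ ∑ (restrict S g)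
∑-enum {zero}  S g = refl
∑-enum {suc n} S g with S zero
... | true  = cong (g zero +_) (∑-enum (S ∘ suc) (g ∘ suc))
... | false = ∑-enum (S ∘ suc) (g ∘ suc)

induced : ∀ {m n} → Graph n → (Fin m → Fin n) → Graph m
induced G f = record
  { adj   = λ i j → adj G (f i) (f j)
  ; sym   = λ i j → Graph.sym G (f i) (f j)
  ; irref = λ i → irref G (f i) }

-- An injective map carries cycles of the induced graph to cycles of G, so
-- induced subgraphs inherit lower bounds on the girth.
induced-girth : ∀ {m n g} (G : Graph n) (f : Fin m → Fin n) → Injective _≡_ _≡_ f →
                GirthAtLeast G g → GirthAtLeast (induced G f) g
induced-girth G f f-inj girth len C = girth len (record
  { m = m ; len≡ = len≡ ; len≥3 = len≥3
  ; v = f ∘ v ; inj = inj ∘ f-inj ; step = step ; close = close })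
  where open Cycle C

increasing-reflects : ∀ {m n} {f : Fin m → Fin n} → StrictlyIncreasing f →
                      ∀ {i j} → f i Fin.< f j → i Fin.< j
increasing-reflects {f = f} inc {i} {j} fi<fj with <-cmp i j
... | tri< i<j _ _ = i<j
... | tri≈ _ refl _ = ⊥-elim (<-irrefl refl fi<fj)
... | tri> _ _ j<i = ⊥-elim (<-asym fi<fj (inc j<i))

increasing-injective : ∀ {m n} {f : Fin m → Fin n} → StrictlyIncreasing f → Injective _≡_ _≡_ f
increasing-injective {f = f} inc {i} {j} fi≡fj with <-cmp i j
... | tri< i<j _ _ = ⊥-elim (<-irrefl fi≡fj (inc i<j))
... | tri≈ _ i≡j _ = i≡j
... | tri> _ _ j<i = ⊥-elim (<-irrefl (sym fi≡fj) (inc j<i))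

edgeIndicator : ∀ {n} → Graph n → Fin n → Fin n → ℕ
edgeIndicator G i j = if ⌊ toℕ i <? toℕ j ⌋ then (if adj G i j then 1 else 0) else 0

edges-∑ : ∀ {n} (G : Graph n) → edges G ≡ ∑ (λ i → ∑ (λ j → edgeIndicator G i j))
edges-∑ {n} G = trans (sum-allFin (λ i → sum (map (edgeIndicator G i) (allFin n))))
                      (sum-cong-≗ (λ i → sum-allFin (edgeIndicator G i)))

edgeIndicator-induced : ∀ {m n} (G : Graph n) {f : Fin m → Fin n} → StrictlyIncreasing f →
  ∀ i j → edgeIndicator (induced G f) i j ≡ edgeIndicator G (f i) (f j)
edgeIndicator-induced G {f} inc i j =
  cong (λ b → if b then (if adj G (f i) (f j) then 1 else 0) else 0) same-order
  where
  fi<?fj : Dec (toℕ (f i) < toℕ (f j))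
  fi<?fj = toℕ (f i) <? toℕ (f j)
  same-order : ⌊ toℕ i <? toℕ j ⌋ ≡ ⌊ toℕ (f i) <? toℕ (f j) ⌋
  same-order with toℕ i <? toℕ j
  ... | yes i<j = sym (trans (isYes≗does fi<?fj) (dec-true fi<?fj (inc i<j)))
  ... | no  i≮j = sym (trans (isYes≗does fi<?fj) (dec-false fi<?fj (i≮j ∘ increasing-reflects inc)))

inside : ∀ {n} → (Fin n → Bool) → (Fin n → Fin n → ℕ) → Fin n → Fin n → ℕ
inside S E u v = if S u then restrict S (E u) v else 0

edges-induced-subset : ∀ {n} (G : Graph n) (S : Fin n → Bool) →
  edges (induced G (enum S)) ≡ ∑ (λ u → ∑ (λ v → inside S (edgeIndicator G) u v))
edges-induced-subset G S = begin
  edges (induced G f)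
    ≡⟨ edges-∑ (induced G f) ⟩
  ∑ (λ i → ∑ (λ j → edgeIndicator (induced G f) i j))
    ≡⟨ sum-cong-≗ (λ i → sum-cong-≗ (edgeIndicator-induced G (enum-increasing S) i)) ⟩
  ∑ (λ i → ∑ (λ j → E (f i) (f j)))
    ≡⟨ sum-cong-≗ (λ i → ∑-enum S (E (f i))) ⟩
  ∑ (λ i → ∑ (restrict S (E (f i))))
    ≡⟨ ∑-enum S (λ u → ∑ (restrict S (E u))) ⟩
  ∑ (restrict S (λ u → ∑ (restrict S (E u))))
    ≡⟨ sum-cong-≗ (λ u → ∑-guard (S u) (restrict S (E u))) ⟩
  ∑ (λ u → ∑ (λ v → inside S E u v)) ∎
  where
  open ≡-Reasoning
  f : Fin (count S) → Fin _
  f = enum S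
  E : Fin _ → Fin _ → ℕ
  E = edgeIndicator G

CoversPairs : ∀ {c n} → (Fin c → Fin n → Bool) → Set
CoversPairs S = ∀ u v → ∃ λ j → S j u ≡ true × S j v ≡ true

-- Every edge of G lies in one of the covering subsets.
edges-≤-∑-induced : ∀ {c n} (G : Graph n) (S : Fin c → Fin n → Bool) → CoversPairs S →
  edges G ≤ ∑ (λ j → edges (induced G (enum (S j))))
edges-≤-∑-induced G S cover = begin
  edges G
    ≡⟨ edges-∑ G ⟩
  ∑ (λ u → ∑ (λ v → E u v))
    ≤⟨ ∑-mono-≤ (λ u → ∑-mono-≤ (edge-covered u)) ⟩
  ∑ (λ u → ∑ (λ v → ∑ (λ j → inside (S j) E u v)))
    ≡⟨ sum-cong-≗ (λ u → ∑-comm (λ v j → inside (S j) E u v)) ⟩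
  ∑ (λ u → ∑ (λ j → ∑ (λ v → inside (S j) E u v)))
    ≡⟨ ∑-comm (λ u j → ∑ (λ v → inside (S j) E u v)) ⟩
  ∑ (λ j → ∑ (λ u → ∑ (λ v → inside (S j) E u v)))
    ≡⟨ sym (sum-cong-≗ (λ j → edges-induced-subset G (S j))) ⟩
  ∑ (λ j → edges (induced G (enum (S j)))) ∎
  where
  open ≤-Reasoning
  E : Fin _ → Fin _ → ℕ
  E = edgeIndicator G
  inside-both : ∀ {T : Fin _ → Bool} {u v} → T u ≡ true → T v ≡ true → inside T E u v ≡ E u v
  inside-both Tu Tv rewrite Tu | Tv = refl
  edge-covered : ∀ u v → E u v ≤ ∑ (λ j → inside (S j) E u v)
  edge-covered u v with cover u v
  ... | j , Su , Sv = subst (_≤ ∑ (λ j → inside (S j) E u v)) (inside-both {S j} Su Sv)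
                            (term-≤-∑ (λ j → inside (S j) E u v) j)

ex-≤-cover : ∀ {c N x g a b} (S : Fin c → Fin N → Bool) → (∀ j → count (S j) ≡ x) →
             CoversPairs S → IsEx N g a → IsEx x g b → a ≤ c * b
ex-≤-cover {c} {N} {x} {g} {a} {b} S size cover ((G , girth , edges≡a) , _) (_ , maximal) = begin
  a                                          ≡⟨ sym edges≡a ⟩
  edges G                                    ≤⟨ edges-≤-∑-induced G S cover ⟩
  ∑ (λ j → edges (induced G (enum (S j))))   ≤⟨ ∑-≤-* part-bound ⟩
  c * b                                      ∎
  where
  open ≤-Reasoning
  Bounded : ℕ → Set
  Bounded m = ∀ (H : Graph m) → GirthAtLeast H g → edges H ≤ b
  part-bound : ∀ j → edges (induced G (enum (S j))) ≤ b
  part-bound j = subst Bounded (sym (size j)) maximal (induced G (enum (S j)))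
    (induced-girth G (enum (S j)) (increasing-injective (enum-increasing (S j))) girth)

-- Consecutive blocks: Fin (∑ ℓ) is cut into blocks of lengths ℓ 0, ℓ 1, …;
-- 'blockOf ℓ u' is the block containing u.
blockOf : ∀ {K} (ℓ : Fin K → ℕ) → Fin (∑ ℓ) → Fin K
blockOf {suc K} ℓ u = [ (λ _ → zero) , suc ∘ blockOf (ℓ ∘ suc) ]′ (splitAt (ℓ zero) u)

count-blocks : ∀ {K} (ℓ : Fin K → ℕ) (σ : Fin K → Bool) → count (σ ∘ blockOf ℓ) ≡ ∑ (restrict σ ℓ)
count-blocks {zero}  ℓ σ = refl
count-blocks {suc K} ℓ σ = begin
  count (σ ∘ blockOf ℓ)
    ≡⟨ ∑-split (ℓ zero) (restrict (σ ∘ blockOf ℓ) (λ _ → 1)) ⟩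
  count (σ ∘ blockOf ℓ ∘ (_↑ˡ ∑ (ℓ ∘ suc))) + count (σ ∘ blockOf ℓ ∘ (ℓ zero ↑ʳ_))
    ≡⟨ cong₂ _+_ (sum-cong-≗ first-block) (sum-cong-≗ later-blocks) ⟩
  count {ℓ zero} (λ _ → σ zero) + count (σ ∘ suc ∘ blockOf (ℓ ∘ suc))
    ≡⟨ cong₂ _+_ (count-const (ℓ zero) (σ zero)) (count-blocks (ℓ ∘ suc) (σ ∘ suc)) ⟩
  ∑ (restrict σ ℓ) ∎
  where
  open ≡-Reasoning
  first-block : ∀ i → restrict (σ ∘ blockOf ℓ ∘ (_↑ˡ ∑ (ℓ ∘ suc))) (λ _ → 1) i
                    ≡ restrict (λ _ → σ zero) (λ _ → 1) i
  first-block i rewrite splitAt-↑ˡ (ℓ zero) i (∑ (ℓ ∘ suc)) = refl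
  later-blocks : ∀ i → restrict (σ ∘ blockOf ℓ ∘ (ℓ zero ↑ʳ_)) (λ _ → 1) i
                     ≡ restrict (σ ∘ suc ∘ blockOf (ℓ ∘ suc)) (λ _ → 1) i
  later-blocks i rewrite splitAt-↑ʳ (ℓ zero) (∑ (ℓ ∘ suc)) i = refl

-- For x = 2q + 3r, block b has length
-- qMult b · q + rMult b · r, i.e. the lengths are r, q, r, q+r, q+r, r, q+r
-- (total 2x); 'design j' selects the blocks of the j-th subset.
qMult rMult : Fin 7 → ℕ
qMult = lookup (0 ∷ 1 ∷ 0 ∷ 1 ∷ 1 ∷ 0 ∷ 1 ∷ [])
rMult = lookup (1 ∷ 0 ∷ 1 ∷ 1 ∷ 1 ∷ 1 ∷ 1 ∷ [])

blockLength : ℕ → ℕ → Fin 7 → ℕ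
blockLength q r b = qMult b * q + rMult b * r

design : Fin 6 → Fin 7 → Bool
design j = lookup (lookup table j)
  where
  table : Vec (Vec Bool 7) 6
  table = (false ∷ false ∷ true  ∷ true  ∷ false ∷ false ∷ true  ∷ [])
        ∷ (false ∷ true  ∷ true  ∷ true  ∷ false ∷ true  ∷ false ∷ [])
        ∷ (true  ∷ false ∷ false ∷ true  ∷ true  ∷ false ∷ false ∷ [])
        ∷ (true  ∷ true  ∷ true  ∷ false ∷ true  ∷ false ∷ false ∷ [])
        ∷ (true  ∷ true  ∷ false ∷ false ∷ false ∷ true  ∷ true  ∷ [])
        ∷ (false ∷ false ∷ false ∷ false ∷ true  ∷ true  ∷ true  ∷ [])
        ∷ []

design-covers : ∀ b b' → ∃ λ j → design j b ≡ true × design j b' ≡ true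
design-covers = toWitness {a? = all? λ b → all? λ b' → any? λ j →
  (design j b ≟ᵇ true) ×-dec (design j b' ≟ᵇ true)} _

design-qMult : ∀ j → ∑ (restrict (design j) qMult) ≡ 2
design-qMult = toWitness {a? = all? λ j → ∑ (restrict (design j) qMult) ≟ 2} _

design-rMult : ∀ j → ∑ (restrict (design j) rMult) ≡ 3
design-rMult = toWitness {a? = all? λ j → ∑ (restrict (design j) rMult) ≟ 3} _

design-size : ∀ q r j → count (design j ∘ blockOf (blockLength q r)) ≡ 2 * q + 3 * r
design-size q r j = begin
  count (design j ∘ blockOf (blockLength q r))            ≡⟨ count-blocks (blockLength q r) (design j) ⟩
  ∑ (restrict (design j) (blockLength q r))               ≡⟨ ∑-restrict-linear (design j) qMult rMult q r ⟩
  ∑ (restrict (design j) qMult) * q + ∑ (restrict (design j) rMult) * r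
    ≡⟨ cong₂ (λ s t → s * q + t * r) (design-qMult j) (design-rMult j) ⟩
  2 * q + 3 * r ∎
  where open ≡-Reasoning

design-total : ∀ q r → ∑ (blockLength q r) ≡ 2 * (2 * q + 3 * r)
design-total q r = trans (∑-restrict-linear (λ _ → true) qMult rMult q r) (regroup q r)
  where
  regroup : ∀ q r → 4 * q + 6 * r ≡ 2 * (2 * q + 3 * r)
  regroup = solve-∀

two-three : ∀ x → 2 ≤ x → ∃₂ λ q r → x ≡ 2 * q + 3 * r
two-three 1 (s≤s ())
two-three 2 _ = 1 , 0 , refl
two-three 3 _ = 0 , 1 , refl
two-three (suc (suc (suc (suc x)))) _ with two-three (suc (suc x)) (s≤s (s≤s z≤n))
... | q , r , x≡ = suc q , r , trans (cong (2 +_) x≡) (add-two q r)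
  where
  add-two : ∀ q r → 2 + (2 * q + 3 * r) ≡ 2 * suc q + 3 * r
  add-two = solve-∀

-- The theorem: the six block unions cover the pairs of Fin (2x), so the
-- covering bound applies.
lemma53 : ∀ (k : ℕ) → 2 ≤ k → ∀ (x : ℕ) → 2 ≤ x →
          ∀ (a b : ℕ) → IsEx (2 * x) (2 * k) a → IsEx x (2 * k) b →
          a ≤ 6 * b
lemma53 k _ x 2≤x a b ex-2x ex-x with two-three x 2≤x
... | q , r , x≡ =
  ex-≤-cover subsets subset-size covers (subst (λ N → IsEx N (2 * k) a) (sym vertices≡) ex-2x) ex-x
  where
  ℓ : Fin 7 → ℕ
  ℓ = blockLength q r
  subsets : Fin 6 → Fin (∑ ℓ) → Bool
  subsets j = design j ∘ blockOf ℓ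
  subset-size : ∀ j → count (subsets j) ≡ x
  subset-size j = trans (design-size q r j) (sym x≡)
  covers : CoversPairs subsets
  covers u v = design-covers (blockOf ℓ u) (blockOf ℓ v)
  vertices≡ : ∑ ℓ ≡ 2 * x
  vertices≡ = trans (design-total q r) (cong (2 *_) (sym x≡))
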